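{- For $n\ge 4$, let $\tau_m(n)$ denote the smallest number $k$ such that there exists an edge coloring $f\colon E(K_n)\to\{1,\dots,k\}$ of the complete graph $K_n$ (not necessarily proper) that distinguishes triangles with respect to multiset palettes. Then $\tau_m(n)\ge n-1$.
   Context: For an edge coloring $f$ of $K_n$ (adjacent edges may receive the same color) and a triangle $T$ of $K_n$, the palette of $T$ is the multiset $F(T)=[f(e): e\in E(T)]$ of the colors of its three edges (so palettes may be of the forms $[\alpha,\beta,\gamma]$, $[\alpha,\alpha,\beta]$ or $[\alpha,\alpha,\alpha]$). The coloring distinguishes triangles if $F(T_1)\neq F(T_2)$ as multisets for every two different triangles $T_1,T_2$ of $K_n$. -}

module Defs where

open import Data.Nat using (ℕ)
open import Data.Fin using (Fin; _<_)
open import Data.List using (List; _∷_; [])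
open import Data.List.Relation.Binary.Permutation.Propositional using (_↭_)
open import Data.Product using (_×_)
open import Relation.Binary.PropositionalEquality using (_≡_)

-- An edge coloring of K_n with colors {1..k} (here Fin k):
-- a symmetric function on pairs of vertices; the value on the diagonal is irrelevant.
record EdgeColoring (n k : ℕ) : Set where
  field
    col : Fin n → Fin n → Fin k
    sym : ∀ u v → col u v ≡ col v u
open EdgeColoring public

record Triangle (n : ℕ) : Set where
  constructor tri
  field
    a b c : Fin n
    a<b : a < b
    b<c : b < c
open Triangle public

-- The palette of a triangle: the list of its three edge colors,
-- compared as a multiset (i.e. up to permutation).
palette : ∀ {n k} → EdgeColoring n k → Triangle n → List (Fin k)
palette f t = col f (a t) (b t) ∷ col f (b t) (c t) ∷ col f (a t) (c t) ∷ []

SameTriangle : ∀ {n} → Triangle n → Triangle n → Set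
SameTriangle t₁ t₂ = (a t₁ ≡ a t₂) × (b t₁ ≡ b t₂) × (c t₁ ≡ c t₂)

DistinguishesTriangles : ∀ {n k} → EdgeColoring n k → Set
DistinguishesTriangles f =
  ∀ t₁ t₂ → palette f t₁ ↭ palette f t₂ → SameTriangle t₁ t₂

-- Fix a colour α and call a pair of an α-edge uv (u < v) and a third vertex x an incidence; there
-- are e_α (n - 2) of them, e_α being the number of α-edges. The triangle uvx has palette
-- [α, f(ux), f(vx)]. Among the two sides other than uv, replace each side of colour α that comes
-- after uv in the order ab, ac, bc of the sides of a triangle a < b < c by a new symbol ★. The
-- resulting 2-multiset over k + 1 symbols determines the incidence: forgetting the stars gives the
-- palette, hence the triangle, and the number of stars tells which α-side of the triangle uv is.
-- So 2 e_α (n - 2) ≤ (k + 1)(k + 2). If k ≤ n - 2 and (k + 1)(k + 2) < (k + 4)(n - 2), integrality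
-- gives 2 e_α ≤ k + 3, and then n (n - 1) = 2 Σ e_α ≤ k (k + 3) < (k + 1)(k + 2) ≤ n (n - 1).
-- The side condition fails only for n = 4, k = 2, where the bound is attained and K₄ is checked
-- exhaustively.
module Submission where

open import Defs hiding (sym)
open import Data.Nat using (ℕ; zero; suc; _+_; _*_; _∸_; _≤_; _<_; z≤n; s≤s; s≤s⁻¹)
open import Data.Nat.Properties
  using (≤-trans; ≤-reflexive; n≤1+n; n<1+n; <-irrefl; ≮⇒≥; m≤n⇒m<n∨m≡n; m≤m+n; m≤n+o⇒m∸n≤o;
         +-mono-≤; *-comm; *-distribʳ-+; *-monoˡ-≤; *-monoʳ-≤; *-mono-≤; *-monoʳ-<; module ≤-Reasoning)
open import Data.Nat.Tactic.RingSolver using (solve-∀)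
open import Data.Fin as Fin using (Fin; zero; suc; inject₁; #_)
open import Data.Fin.Properties
  using (_≟_; <-cmp; <-irrelevant; ≤-total; 0≢1+n; suc-injective; inject₁-injective; ≤̄⇒inject₁<;
         ≤-decTotalOrder; all?)
open import Data.List using (List; []; _∷_; _++_; map; length; filter; allFin; tabulate)
open import Data.List.Properties using (length-++; length-++-sucʳ; length-map; length-tabulate; ≡-dec)
open import Data.List.Membership.Propositional using (_∈_)
open import Data.List.Membership.Propositional.Properties
  using (∈-∃++; ∈-++⁻; ∈-++⁺ˡ; ∈-++⁺ʳ; ∈-map⁺; ∈-map⁻; ∈-tabulate⁺; ∈-tabulate⁻; ∈-filter⁺; ∈-filter⁻; ∈-allFin)
open import Data.List.Relation.Unary.Any using (here; there)
open import Data.List.Relation.Unary.All as All using ([]; _∷_)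
open import Data.List.Relation.Unary.AllPairs using ([]; _∷_)
open import Data.List.Relation.Unary.Unique.Propositional using (Unique)
import Data.List.Relation.Unary.Unique.Propositional.Properties as Unique
open import Data.List.Relation.Unary.Unique.DecPropositional (≡-dec (_≟_ {2})) using (unique?)
open import Data.List.Relation.Binary.Permutation.Propositional
  using (_↭_; ↭-refl; ↭-trans; ↭-reflexive; prep; swap; module PermutationReasoning)
import Data.List.Sort.InsertionSort.Base as InsertionSort
import Data.List.Sort.InsertionSort.Properties as InsertionSortₚ
open import Data.Product as Product using (Σ; _×_; _,_; proj₁; proj₂; uncurry)
open import Data.Sum using (_⊎_; inj₁; inj₂)
open import Data.Empty using (⊥-elim)
open import Function using (id)
open import Relation.Nullary using (¬_; Dec; yes; no; contradiction; ¬?; _×-dec_)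
open import Relation.Nullary.Decidable using (from-yes)
open import Relation.Binary.Definitions using (tri<; tri≈; tri>)
open import Relation.Binary.PropositionalEquality
  using (_≡_; _≢_; refl; sym; trans; cong; cong₂; module ≡-Reasoning)

-- Counting with lists

module _ {a b} {A : Set a} {B : Set b} where

  injection⇒length≤ : {xs : List A} {ys : List B} → Unique xs →
                      (f : ∀ {x} → x ∈ xs → B) →
                      (∀ {x} (x∈xs : x ∈ xs) → f x∈xs ∈ ys) →
                      (∀ {x y} (x∈xs : x ∈ xs) (y∈xs : y ∈ xs) → f x∈xs ≡ f y∈xs → x ≡ y) →
                      length xs ≤ length ys
  injection⇒length≤ {[]} _ _ _ _ = z≤n
  injection⇒length≤ {x ∷ xs} (x∉xs ∷ xs!) f f∈ys f-injective with ∈-∃++ (f∈ys (here refl))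
  ... | ys₁ , ys₂ , refl = begin
    suc (length xs)                      ≤⟨ s≤s (injection⇒length≤ xs! (λ z∈xs → f (there z∈xs)) f∈ys₁++ys₂
                                               (λ y∈xs z∈xs → f-injective (there y∈xs) (there z∈xs))) ⟩
    suc (length (ys₁ ++ ys₂))            ≡⟨ length-++-sucʳ ys₁ (f (here refl)) ys₂ ⟨
    length (ys₁ ++ f (here refl) ∷ ys₂)  ∎
    where
    open ≤-Reasoning
    f∈ys₁++ys₂ : ∀ {z} (z∈xs : z ∈ xs) → f (there z∈xs) ∈ ys₁ ++ ys₂
    f∈ys₁++ys₂ z∈xs with ∈-++⁻ ys₁ (f∈ys (there z∈xs))
    ... | inj₁ ∈ys₁         = ∈-++⁺ˡ ∈ys₁
    ... | inj₂ (there ∈ys₂) = ∈-++⁺ʳ ys₁ ∈ys₂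
    ... | inj₂ (here f≡)    =
      contradiction (f-injective (here refl) (there z∈xs) (sym f≡)) (All.lookup x∉xs z∈xs)

  dependentProduct : List A → (A → List B) → List (A × B)
  dependentProduct []       g = []
  dependentProduct (x ∷ xs) g = map (x ,_) (g x) ++ dependentProduct xs g

  module _ {g : A → List B} where

    ∈-dependentProduct⁺ : ∀ {xs x y} → x ∈ xs → y ∈ g x → (x , y) ∈ dependentProduct xs g
    ∈-dependentProduct⁺ {x ∷ _} (here refl) y∈ = ∈-++⁺ˡ (∈-map⁺ (x ,_) y∈)
    ∈-dependentProduct⁺ {x ∷ _} (there x∈) y∈ = ∈-++⁺ʳ (map (x ,_) (g x)) (∈-dependentProduct⁺ x∈ y∈)

    ∈-dependentProduct⁻ : ∀ xs {z} → z ∈ dependentProduct xs g → proj₁ z ∈ xs × proj₂ z ∈ g (proj₁ z)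
    ∈-dependentProduct⁻ (x ∷ xs) z∈ with ∈-++⁻ (map (x ,_) (g x)) z∈
    ... | inj₂ z∈rest = Product.map₁ there (∈-dependentProduct⁻ xs z∈rest)
    ... | inj₁ z∈map with ∈-map⁻ (x ,_) z∈map
    ...   | _ , y∈ , refl = here refl , y∈

    dependentProduct-unique : ∀ {xs} → Unique xs → (∀ x → Unique (g x)) → Unique (dependentProduct xs g)
    dependentProduct-unique {[]}     []           _  = []
    dependentProduct-unique {x ∷ xs} (x∉xs ∷ xs!) g! =
      Unique.++⁺ (Unique.map⁺ (cong proj₂) (g! x)) (dependentProduct-unique xs! g!) disjoint
      where
      disjoint : ∀ {z} → ¬ (z ∈ map (x ,_) (g x) × z ∈ dependentProduct xs g)
      disjoint (z∈map , z∈rest) with ∈-map⁻ (x ,_) z∈map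
      ... | _ , _ , refl = All.lookup x∉xs (proj₁ (∈-dependentProduct⁻ xs z∈rest)) refl

    length-dependentProduct-∷ : ∀ x xs →
      length (dependentProduct (x ∷ xs) g) ≡ length (g x) + length (dependentProduct xs g)
    length-dependentProduct-∷ x xs =
      trans (length-++ (map (x ,_) (g x))) (cong (_+ _) (length-map (x ,_) (g x)))

    length-dependentProduct-≥ : ∀ {c} → (∀ x → c ≤ length (g x)) →
                                ∀ xs → length xs * c ≤ length (dependentProduct xs g)
    length-dependentProduct-≥ bound []       = z≤n
    length-dependentProduct-≥ bound (x ∷ xs) = ≤-trans
      (+-mono-≤ (bound x) (length-dependentProduct-≥ bound xs))
      (≤-reflexive (sym (length-dependentProduct-∷ x xs)))

    length-dependentProduct-≤ : ∀ {c d} → (∀ x → length (g x) * c ≤ d) →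
                                ∀ xs → length (dependentProduct xs g) * c ≤ length xs * d
    length-dependentProduct-≤ bound []           = z≤n
    length-dependentProduct-≤ {c} bound (x ∷ xs) = begin
      length (dependentProduct (x ∷ xs) g) * c              ≡⟨ cong (_* c) (length-dependentProduct-∷ x xs) ⟩
      (length (g x) + length (dependentProduct xs g)) * c    ≡⟨ *-distribʳ-+ c (length (g x)) _ ⟩
      length (g x) * c + length (dependentProduct xs g) * c  ≤⟨ +-mono-≤ (bound x)
                                                                  (length-dependentProduct-≤ bound xs) ⟩
      _ + length xs * _                                      ∎
      where open ≤-Reasoning

pairWithZero : ∀ {n} → Fin n → Fin (suc n) × Fin (suc n)
pairWithZero v = zero , suc v

sucPair : ∀ {n} → Fin n × Fin n → Fin (suc n) × Fin (suc n)
sucPair = Product.map suc suc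

increasingPairs : ∀ n → List (Fin n × Fin n)
increasingPairs zero    = []
increasingPairs (suc n) = tabulate pairWithZero ++ map sucPair (increasingPairs n)

∈-increasingPairs⁺ : ∀ {n} {u v : Fin n} → u Fin.< v → (u , v) ∈ increasingPairs n
∈-increasingPairs⁺ {u = zero}  {suc v} _         = ∈-++⁺ˡ (∈-tabulate⁺ v)
∈-increasingPairs⁺ {u = suc u} {suc v} (s≤s u<v) = ∈-++⁺ʳ _ (∈-map⁺ sucPair (∈-increasingPairs⁺ u<v))

∈-increasingPairs⁻ : ∀ {n} {p : Fin n × Fin n} → p ∈ increasingPairs n → proj₁ p Fin.< proj₂ p
∈-increasingPairs⁻ {suc n} p∈ with ∈-++⁻ (tabulate pairWithZero) p∈
... | inj₁ p∈new with ∈-tabulate⁻ p∈new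
...   | _ , refl = s≤s z≤n
∈-increasingPairs⁻ {suc n} p∈ | inj₂ p∈old with ∈-map⁻ sucPair p∈old
...   | _ , uv∈ , refl = s≤s (∈-increasingPairs⁻ uv∈)

increasingPairs-unique : ∀ n → Unique (increasingPairs n)
increasingPairs-unique zero    = []
increasingPairs-unique (suc n) =
  Unique.++⁺ (Unique.tabulate⁺ (λ eq → suc-injective (cong proj₂ eq)))
             (Unique.map⁺ sucPair-injective (increasingPairs-unique n)) disjoint
  where
  sucPair-injective : ∀ {p q : Fin n × Fin n} → sucPair p ≡ sucPair q → p ≡ q
  sucPair-injective refl = refl
  disjoint : ∀ {p} → ¬ (p ∈ tabulate pairWithZero × p ∈ map sucPair (increasingPairs n))
  disjoint (p∈new , p∈old) with ∈-tabulate⁻ {f = pairWithZero} p∈new | ∈-map⁻ sucPair p∈old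
  ... | _ , refl | _ , _ , ()

length-increasingPairs : ∀ n → length (increasingPairs (suc n)) * 2 ≡ suc n * n
length-increasingPairs zero    = refl
length-increasingPairs (suc n) = begin
  length (increasingPairs (2 + n)) * 2              ≡⟨ cong (_* 2) length-step ⟩
  (suc n + length (increasingPairs (suc n))) * 2    ≡⟨ *-distribʳ-+ 2 (suc n) _ ⟩
  suc n * 2 + length (increasingPairs (suc n)) * 2  ≡⟨ cong (suc n * 2 +_) (length-increasingPairs n) ⟩
  suc n * 2 + suc n * n                             ≡⟨ triangular n ⟩
  (2 + n) * suc n                                   ∎
  where
  open ≡-Reasoning
  length-step : length (increasingPairs (2 + n)) ≡ suc n + length (increasingPairs (suc n))
  length-step = trans (length-++ (tabulate (pairWithZero {suc n})))
                      (cong₂ _+_ (length-tabulate pairWithZero) (length-map sucPair (increasingPairs (suc n))))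
  triangular : ∀ n → suc n * 2 + suc n * n ≡ (2 + n) * suc n
  triangular = solve-∀

avoids? : ∀ {n} (u v x : Fin n) → Dec (x ≢ u × x ≢ v)
avoids? u v x = ¬? (x ≟ u) ×-dec ¬? (x ≟ v)

others : ∀ {n} → Fin n → Fin n → List (Fin n)
others u v = filter (avoids? u v) (allFin _)

∈-others⁻ : ∀ {n} {u v x : Fin n} → x ∈ others u v → x ≢ u × x ≢ v
∈-others⁻ {n} {u} {v} x∈ = proj₂ (∈-filter⁻ (avoids? u v) {xs = allFin n} x∈)

others-unique : ∀ {n} (u v : Fin n) → Unique (others u v)
others-unique {n} u v = Unique.filter⁺ (avoids? u v) (Unique.allFin⁺ n)

length-others : ∀ {n} (u v : Fin n) → n ∸ 2 ≤ length (others u v)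
length-others {n} u v = m≤n+o⇒m∸n≤o n 2 (begin
  n                            ≡⟨ length-tabulate id ⟨
  length (allFin n)            ≤⟨ injection⇒length≤ (Unique.allFin⁺ n) (λ {x} _ → x)
                                    (λ {x} _ → covered x) (λ _ _ → id) ⟩
  length (u ∷ v ∷ others u v)  ∎)
  where
  open ≤-Reasoning
  covered : ∀ x → x ∈ u ∷ v ∷ others u v
  covered x with x ≟ u | x ≟ v
  ... | yes x≡u | _       = here x≡u
  ... | no _    | yes x≡v = there (here x≡v)
  ... | no x≢u  | no x≢v  = there (there (∈-filter⁺ (avoids? u v) (∈-allFin x) (x≢u , x≢v)))

-- Stars and bars: {p ≤ q} ↦ {p < q + 1} identifies the 2-multisets of Fin (suc k) with the
-- 2-subsets of Fin (2 + k).
starsAndBars : ∀ {k} → Fin (suc k) × Fin (suc k) → Fin (2 + k) × Fin (2 + k)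
starsAndBars (p , q) with ≤-total p q
... | inj₁ _ = inject₁ p , suc q
... | inj₂ _ = inject₁ q , suc p

starsAndBars∈increasingPairs : ∀ {k} (m : Fin (suc k) × Fin (suc k)) → starsAndBars m ∈ increasingPairs (2 + k)
starsAndBars∈increasingPairs (p , q) with ≤-total p q
... | inj₁ p≤q = ∈-increasingPairs⁺ (≤̄⇒inject₁< p≤q)
... | inj₂ q≤p = ∈-increasingPairs⁺ (≤̄⇒inject₁< q≤p)

inject₁×suc-injective : ∀ {k} {p q r s : Fin (suc k)} →
                        (inject₁ p , suc q) ≡ (inject₁ r , suc s) → p ≡ r × q ≡ s
inject₁×suc-injective eq = inject₁-injective (cong proj₁ eq) , suc-injective (cong proj₂ eq)

starsAndBars-injective : ∀ {k} {m₁ m₂ : Fin (suc k) × Fin (suc k)} →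
                         starsAndBars m₁ ≡ starsAndBars m₂ → m₁ ≡ m₂ ⊎ m₁ ≡ Product.swap m₂
starsAndBars-injective {m₁ = p₁ , q₁} {p₂ , q₂} eq with ≤-total p₁ q₁ | ≤-total p₂ q₂
... | inj₁ _ | inj₁ _ with refl , refl ← inject₁×suc-injective eq = inj₁ refl
... | inj₁ _ | inj₂ _ with refl , refl ← inject₁×suc-injective eq = inj₂ refl
... | inj₂ _ | inj₁ _ with refl , refl ← inject₁×suc-injective eq = inj₂ refl
... | inj₂ _ | inj₂ _ with refl , refl ← inject₁×suc-injective eq = inj₁ refl

-- Triangles with a distinguished side

data Side : Set where
  ab ac bc : Side

ends : ∀ {n} → Triangle n → Side → Fin n × Fin n
ends t ab = a t , b t
ends t ac = a t , c t
ends t bc = b t , c t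

apex : ∀ {n} → Triangle n → Side → Fin n
apex t ab = c t
apex t ac = b t
apex t bc = a t

SameTriangle⇒≡ : ∀ {n} {t₁ t₂ : Triangle n} → SameTriangle t₁ t₂ → t₁ ≡ t₂
SameTriangle⇒≡ {t₁ = tri u v w u<v₁ v<w₁} {tri _ _ _ u<v₂ v<w₂} (refl , refl , refl) =
  cong₂ (tri u v w) (<-irrelevant u<v₁ u<v₂) (<-irrelevant v<w₁ v<w₂)

record Placement {n} (u v x : Fin n) : Set where
  field
    triangle : Triangle n
    side     : Side
    ends≡    : ends triangle side ≡ (u , v)
    apex≡    : apex triangle side ≡ x
open Placement

place : ∀ {n} {u v x : Fin n} → u Fin.< v → x ≢ u → x ≢ v → Placement u v x
place {u = u} {v} {x} u<v x≢u x≢v with <-cmp x u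
... | tri< x<u _ _ = record { triangle = tri x u v x<u u<v ; side = bc ; ends≡ = refl ; apex≡ = refl }
... | tri≈ _ x≡u _ = contradiction x≡u x≢u
... | tri> _ _ u<x with <-cmp x v
...   | tri< x<v _ _ = record { triangle = tri u x v u<x x<v ; side = ac ; ends≡ = refl ; apex≡ = refl }
...   | tri≈ _ x≡v _ = contradiction x≡v x≢v
...   | tri> _ _ v<x = record { triangle = tri u v x u<v v<x ; side = ab ; ends≡ = refl ; apex≡ = refl }

placement-injective : ∀ {n} {u₁ v₁ x₁ u₂ v₂ x₂ : Fin n} (P₁ : Placement u₁ v₁ x₁) (P₂ : Placement u₂ v₂ x₂) →
                      triangle P₁ ≡ triangle P₂ → side P₁ ≡ side P₂ → ((u₁ , v₁) , x₁) ≡ ((u₂ , v₂) , x₂)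
placement-injective P₁ P₂ t≡ s≡ = cong₂ _,_
  (trans (sym (ends≡ P₁)) (trans (cong₂ ends t≡ s≡) (ends≡ P₂)))
  (trans (sym (apex≡ P₁)) (trans (cong₂ apex t≡ s≡) (apex≡ P₂)))

module _ {n k} (f : EdgeColoring n k) where

  sideColour : Triangle n → Side → Fin k
  sideColour t s = uncurry (col f) (ends t s)

  otherColours : Triangle n → Side → List (Fin k)
  otherColours t ab = col f (a t) (c t) ∷ col f (b t) (c t) ∷ []
  otherColours t ac = col f (a t) (b t) ∷ col f (b t) (c t) ∷ []
  otherColours t bc = col f (a t) (b t) ∷ col f (a t) (c t) ∷ []

  palette↭side∷others : ∀ t s → palette f t ↭ sideColour t s ∷ otherColours t s
  palette↭side∷others t ab = prep _ (swap _ _ ↭-refl)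
  palette↭side∷others t ac = ↭-trans (prep _ (swap _ _ ↭-refl)) (swap _ _ ↭-refl)
  palette↭side∷others t bc = swap _ _ ↭-refl

-- The key of an α-side

module Marking {n k} (f : EdgeColoring n k) (α : Fin k) where

  -- zero is the star ★; suc γ stands for γ itself.
  mark : Fin k → Fin (suc k)
  mark γ with γ ≟ α
  ... | yes _ = zero
  ... | no _  = suc γ

  mark-α : ∀ {γ} → γ ≡ α → mark γ ≡ zero
  mark-α {γ} γ≡α with γ ≟ α
  ... | yes _  = refl
  ... | no γ≢α = contradiction γ≡α γ≢α

  unmark : Fin (suc k) → Fin k
  unmark zero    = α
  unmark (suc γ) = γ

  unmark-mark : ∀ γ → unmark (mark γ) ≡ γ
  unmark-mark γ with γ ≟ α
  ... | yes γ≡α = sym γ≡α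
  ... | no _    = refl

  markedOthers : Triangle n → Side → Fin (suc k) × Fin (suc k)
  markedOthers t ab = mark (col f (a t) (c t)) , mark (col f (b t) (c t))
  markedOthers t ac = suc (col f (a t) (b t)) , mark (col f (b t) (c t))
  markedOthers t bc = suc (col f (a t) (b t)) , suc (col f (a t) (c t))

  unmark₂ : Fin (suc k) × Fin (suc k) → List (Fin k)
  unmark₂ (p , q) = unmark p ∷ unmark q ∷ []

  unmark₂-markedOthers : ∀ t s → unmark₂ (markedOthers t s) ≡ otherColours f t s
  unmark₂-markedOthers t ab = cong₂ (λ γ δ → γ ∷ δ ∷ []) (unmark-mark _) (unmark-mark _)
  unmark₂-markedOthers t ac = cong (λ δ → _ ∷ δ ∷ []) (unmark-mark _)
  unmark₂-markedOthers t bc = refl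

  unmark₂-resp : ∀ {m₁ m₂} → m₁ ≡ m₂ ⊎ m₁ ≡ Product.swap m₂ → unmark₂ m₁ ↭ unmark₂ m₂
  unmark₂-resp (inj₁ refl) = ↭-refl
  unmark₂-resp (inj₂ refl) = swap _ _ ↭-refl

  palette↭α∷unmarked : ∀ {t s} → sideColour f t s ≡ α → palette f t ↭ α ∷ unmark₂ (markedOthers t s)
  palette↭α∷unmarked {t} {s} coloured = ↭-trans (palette↭side∷others f t s)
    (↭-reflexive (cong₂ _∷_ coloured (sym (unmark₂-markedOthers t s))))

  marked≢unmarked : ∀ {γ δ} → γ ≡ α → mark γ ≢ suc δ
  marked≢unmarked γ≡α eq = 0≢1+n (trans (sym (mark-α γ≡α)) eq)

  -- A later α-side is starred in the marks of an earlier one but never in its own, so in every case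
  -- below a ★ would have to equal an unstarred entry.
  markedOthers-injective : ∀ {t s₁ s₂} → sideColour f t s₁ ≡ α → sideColour f t s₂ ≡ α →
    markedOthers t s₁ ≡ markedOthers t s₂ ⊎ markedOthers t s₁ ≡ Product.swap (markedOthers t s₂) → s₁ ≡ s₂
  markedOthers-injective {s₁ = ab} {ab} _ _ _        = refl
  markedOthers-injective {s₁ = ac} {ac} _ _ _        = refl
  markedOthers-injective {s₁ = bc} {bc} _ _ _        = refl
  markedOthers-injective {s₁ = ab} {ac} _ h (inj₁ e) = ⊥-elim (marked≢unmarked h (cong proj₁ e))
  markedOthers-injective {s₁ = ab} {ac} _ h (inj₂ e) = ⊥-elim (marked≢unmarked h (trans (cong proj₁ e) (cong proj₂ e)))
  markedOthers-injective {s₁ = ab} {bc} _ h (inj₁ e) = ⊥-elim (marked≢unmarked h (cong proj₂ e))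
  markedOthers-injective {s₁ = ab} {bc} _ h (inj₂ e) = ⊥-elim (marked≢unmarked h (cong proj₂ e))
  markedOthers-injective {s₁ = ac} {bc} _ h (inj₁ e) = ⊥-elim (marked≢unmarked h (cong proj₂ e))
  markedOthers-injective {s₁ = ac} {bc} _ h (inj₂ e) = ⊥-elim (marked≢unmarked h (cong proj₂ e))
  markedOthers-injective {s₁ = ac} {ab} h _ (inj₁ e) = ⊥-elim (marked≢unmarked h (sym (cong proj₁ e)))
  markedOthers-injective {s₁ = ac} {ab} h _ (inj₂ e) = ⊥-elim (marked≢unmarked h (sym (trans (cong proj₁ e) (cong proj₂ e))))
  markedOthers-injective {s₁ = bc} {ab} h _ (inj₁ e) = ⊥-elim (marked≢unmarked h (sym (cong proj₂ e)))
  markedOthers-injective {s₁ = bc} {ab} h _ (inj₂ e) = ⊥-elim (marked≢unmarked h (sym (cong proj₁ e)))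
  markedOthers-injective {s₁ = bc} {ac} h _ (inj₁ e) = ⊥-elim (marked≢unmarked h (sym (cong proj₂ e)))
  markedOthers-injective {s₁ = bc} {ac} h _ (inj₂ e) = ⊥-elim (marked≢unmarked h (sym (cong proj₁ e)))

  key : Triangle n → Side → Fin (2 + k) × Fin (2 + k)
  key t s = starsAndBars (markedOthers t s)

  sameKey⇒palette↭ : ∀ {t₁ s₁ t₂ s₂} → sideColour f t₁ s₁ ≡ α → sideColour f t₂ s₂ ≡ α →
                     key t₁ s₁ ≡ key t₂ s₂ → palette f t₁ ↭ palette f t₂
  sameKey⇒palette↭ {t₁} {s₁} {t₂} {s₂} coloured₁ coloured₂ eq = begin
    palette f t₁                      ↭⟨ palette↭α∷unmarked {t₁} {s₁} coloured₁ ⟩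
    α ∷ unmark₂ (markedOthers t₁ s₁)  ↭⟨ prep α (unmark₂-resp (starsAndBars-injective eq)) ⟩
    α ∷ unmark₂ (markedOthers t₂ s₂)  ↭⟨ palette↭α∷unmarked {t₂} {s₂} coloured₂ ⟨
    palette f t₂                      ∎
    where open PermutationReasoning

  key-injective : DistinguishesTriangles f → ∀ {t₁ s₁ t₂ s₂} → sideColour f t₁ s₁ ≡ α → sideColour f t₂ s₂ ≡ α →
                  key t₁ s₁ ≡ key t₂ s₂ → t₁ ≡ t₂ × s₁ ≡ s₂
  key-injective distinguishes {t₁} {s₁} {t₂} {s₂} coloured₁ coloured₂ eq
    with refl ← SameTriangle⇒≡ {t₁ = t₁} {t₂}
                  (distinguishes t₁ t₂ (sameKey⇒palette↭ {t₁} {s₁} {t₂} {s₂} coloured₁ coloured₂ eq))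
    = refl , markedOthers-injective {t₁} {s₁} {s₂} coloured₁ coloured₂ (starsAndBars-injective eq)

-- Counting colour classes

module _ {n k} (f : EdgeColoring n k) where

  hasColour? : ∀ α (e : Fin n × Fin n) → Dec (uncurry (col f) e ≡ α)
  hasColour? α e = uncurry (col f) e ≟ α

  colourClass : Fin k → List (Fin n × Fin n)
  colourClass α = filter (hasColour? α) (increasingPairs n)

  incidences : Fin k → List ((Fin n × Fin n) × Fin n)
  incidences α = dependentProduct (colourClass α) (uncurry others)

  incidences-unique : ∀ α → Unique (incidences α)
  incidences-unique α =
    dependentProduct-unique (Unique.filter⁺ (hasColour? α) (increasingPairs-unique n)) (uncurry others-unique)

  placeIncidence : ∀ {α u v x} → ((u , v) , x) ∈ incidences α → Placement u v x
  placeIncidence {α} d∈ with uv∈ , x∈ ← ∈-dependentProduct⁻ (colourClass α) d∈ =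
    place (∈-increasingPairs⁻ (proj₁ (∈-filter⁻ (hasColour? α) {xs = increasingPairs n} uv∈)))
          (proj₁ (∈-others⁻ x∈)) (proj₂ (∈-others⁻ x∈))

  placeIncidence-colour : ∀ {α u v x} (d∈ : ((u , v) , x) ∈ incidences α) →
                          sideColour f (triangle (placeIncidence d∈)) (side (placeIncidence d∈)) ≡ α
  placeIncidence-colour {α} d∈ = trans (cong (uncurry (col f)) (ends≡ (placeIncidence d∈)))
    (proj₂ (∈-filter⁻ (hasColour? α) {xs = increasingPairs n} (proj₁ (∈-dependentProduct⁻ (colourClass α) d∈))))

  incidenceKey : ∀ {α u v x} → ((u , v) , x) ∈ incidences α → Fin (2 + k) × Fin (2 + k)
  incidenceKey {α} d∈ = Marking.key f α (triangle (placeIncidence d∈)) (side (placeIncidence d∈))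

  incidenceKey-injective : DistinguishesTriangles f → ∀ {α d₁ d₂}
                           (d₁∈ : d₁ ∈ incidences α) (d₂∈ : d₂ ∈ incidences α) →
                           incidenceKey d₁∈ ≡ incidenceKey d₂∈ → d₁ ≡ d₂
  incidenceKey-injective distinguishes {α} d₁∈ d₂∈ eq =
    uncurry (placement-injective (placeIncidence d₁∈) (placeIncidence d₂∈))
      (Marking.key-injective f α distinguishes (placeIncidence-colour d₁∈) (placeIncidence-colour d₂∈) eq)

  colourClass-bound : DistinguishesTriangles f → ∀ α → length (colourClass α) * (n ∸ 2) * 2 ≤ (2 + k) * (1 + k)
  colourClass-bound distinguishes α = begin
    length (colourClass α) * (n ∸ 2) * 2  ≤⟨ *-monoˡ-≤ 2 (begin
      length (colourClass α) * (n ∸ 2)      ≤⟨ length-dependentProduct-≥ (uncurry length-others) (colourClass α) ⟩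
      length (incidences α)                 ≤⟨ injection⇒length≤ (incidences-unique α) incidenceKey
                                                 (λ _ → starsAndBars∈increasingPairs _)
                                                 (incidenceKey-injective distinguishes) ⟩
      length (increasingPairs (2 + k))      ∎) ⟩
    length (increasingPairs (2 + k)) * 2  ≡⟨ length-increasingPairs (suc k) ⟩
    (2 + k) * (1 + k)                     ∎
    where open ≤-Reasoning

  increasingPairs-bound : ∀ {c d} → (∀ α → length (colourClass α) * c ≤ d) →
                          length (increasingPairs n) * c ≤ k * d
  increasingPairs-bound {c} {d} bound = begin
    length (increasingPairs n) * c                        ≤⟨ *-monoˡ-≤ c cover ⟩
    length (dependentProduct (allFin k) colourClass) * c  ≤⟨ length-dependentProduct-≤ bound (allFin k) ⟩
    length (allFin k) * d                                 ≡⟨ cong (_* d) (length-tabulate {n = k} id) ⟩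
    k * d                                                 ∎
    where
    open ≤-Reasoning
    cover : length (increasingPairs n) ≤ length (dependentProduct (allFin k) colourClass)
    cover = injection⇒length≤ (increasingPairs-unique n) (λ {e} _ → uncurry (col f) e , e)
      (λ e∈ → ∈-dependentProduct⁺ (∈-allFin _) (∈-filter⁺ (hasColour? _) e∈ refl)) (λ _ _ → cong proj₂)

-- This is what lets integrality round 2 e_α down to k + 3.
Slack : ℕ → ℕ → Set
Slack k m = (1 + k) * (2 + k) < (4 + k) * m

<⇒Slack : ∀ {k m} → k < m → Slack k m
<⇒Slack {k} {m} k<m = begin-strict
  (1 + k) * (2 + k)  <⟨ *-monoʳ-< (1 + k) (s≤s (s≤s (s≤s (n≤1+n k)))) ⟩
  (1 + k) * (4 + k)  ≡⟨ *-comm (1 + k) (4 + k) ⟩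
  (4 + k) * (1 + k)  ≤⟨ *-monoʳ-≤ (4 + k) k<m ⟩
  (4 + k) * m        ∎
  where open ≤-Reasoning

2<⇒Slack-diagonal : ∀ {m} → 2 < m → Slack m m
2<⇒Slack-diagonal {suc (suc (suc j))} (s≤s (s≤s (s≤s _))) = begin-strict
  (4 + j) * (5 + j)            <⟨ n<1+n _ ⟩
  suc ((4 + j) * (5 + j))      ≤⟨ m≤m+n _ j ⟩
  suc ((4 + j) * (5 + j)) + j  ≡⟨ expand j ⟩
  (7 + j) * (3 + j)            ∎
  where
  open ≤-Reasoning
  expand : ∀ j → suc ((4 + j) * (5 + j)) + j ≡ (7 + j) * (3 + j)
  expand = solve-∀

Slack⇒e*2≤3+k : ∀ {k m e} → Slack k m → e * m * 2 ≤ (2 + k) * (1 + k) → e * 2 ≤ 3 + k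
Slack⇒e*2≤3+k {k} {m} {e} slack bound = ≮⇒≥ λ 3+k<e*2 → <-irrefl refl (begin-strict
  (4 + k) * m        ≤⟨ *-monoˡ-≤ m 3+k<e*2 ⟩
  e * 2 * m          ≡⟨ reorder e m ⟩
  e * m * 2          ≤⟨ bound ⟩
  (2 + k) * (1 + k)  ≡⟨ *-comm (2 + k) (1 + k) ⟩
  (1 + k) * (2 + k)  <⟨ slack ⟩
  (4 + k) * m        ∎)
  where
  open ≤-Reasoning
  reorder : ∀ e m → e * 2 * m ≡ e * m * 2
  reorder = solve-∀

Slack⇒¬distinguishes : ∀ {m k} → k ≤ m → Slack k m → (f : EdgeColoring (2 + m) k) → ¬ DistinguishesTriangles f
Slack⇒¬distinguishes {m} {k} k≤m slack f distinguishes = <-irrefl refl (begin-strict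
  (2 + m) * (1 + m)                     ≡⟨ length-increasingPairs (suc m) ⟨
  length (increasingPairs (2 + m)) * 2  ≤⟨ increasingPairs-bound f colourClass-half-bound ⟩
  k * (3 + k)                           <⟨ n<1+n _ ⟩
  suc (k * (3 + k))                     <⟨ n<1+n _ ⟩
  2 + k * (3 + k)                       ≡⟨ expand k ⟩
  (1 + k) * (2 + k)                     ≤⟨ *-mono-≤ (s≤s k≤m) (s≤s (s≤s k≤m)) ⟩
  (1 + m) * (2 + m)                     ≡⟨ *-comm (1 + m) (2 + m) ⟩
  (2 + m) * (1 + m)                     ∎)
  where
  open ≤-Reasoning
  colourClass-half-bound : ∀ α → length (colourClass f α) * 2 ≤ 3 + k
  colourClass-half-bound α =
    Slack⇒e*2≤3+k {e = length (colourClass f α)} slack (colourClass-bound f distinguishes α)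
  expand : ∀ k → 2 + k * (3 + k) ≡ (1 + k) * (2 + k)
  expand = solve-∀

-- K₄ with two colours

sortᶠ : ∀ {k} → List (Fin k) → List (Fin k)
sortᶠ {k} = InsertionSort.sort (≤-decTotalOrder k)

sortedPalette-injective : ∀ {n k} {f : EdgeColoring n k} → DistinguishesTriangles f → ∀ {t₁ t₂} →
                          sortᶠ (palette f t₁) ≡ sortᶠ (palette f t₂) → t₁ ≡ t₂
sortedPalette-injective {k = k} {f} distinguishes {t₁} {t₂} eq =
  SameTriangle⇒≡ {t₁ = t₁} {t₂} (distinguishes t₁ t₂ (begin
    palette f t₁          ↭⟨ InsertionSortₚ.sort-↭ (≤-decTotalOrder k) (palette f t₁) ⟨
    sortᶠ (palette f t₁)  ≡⟨ eq ⟩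
    sortᶠ (palette f t₂)  ↭⟨ InsertionSortₚ.sort-↭ (≤-decTotalOrder k) (palette f t₂) ⟩
    palette f t₂          ∎))
  where open PermutationReasoning

K₄-triangles : List (Triangle 4)
K₄-triangles =
  tri (# 0) (# 1) (# 2) (s≤s z≤n) (s≤s (s≤s z≤n)) ∷
  tri (# 0) (# 1) (# 3) (s≤s z≤n) (s≤s (s≤s z≤n)) ∷
  tri (# 0) (# 2) (# 3) (s≤s z≤n) (s≤s (s≤s (s≤s z≤n))) ∷
  tri (# 1) (# 2) (# 3) (s≤s (s≤s z≤n)) (s≤s (s≤s (s≤s z≤n))) ∷ []

K₄-triangles-unique : Unique K₄-triangles
K₄-triangles-unique = ((λ ()) ∷ (λ ()) ∷ (λ ()) ∷ []) ∷ ((λ ()) ∷ (λ ()) ∷ []) ∷ ((λ ()) ∷ []) ∷ [] ∷ []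

K₄-sortedPalettes : (c₀₁ c₀₂ c₀₃ c₁₂ c₁₃ c₂₃ : Fin 2) → List (List (Fin 2))
K₄-sortedPalettes c₀₁ c₀₂ c₀₃ c₁₂ c₁₃ c₂₃ =
  sortᶠ (c₀₁ ∷ c₁₂ ∷ c₀₂ ∷ []) ∷ sortᶠ (c₀₁ ∷ c₁₃ ∷ c₀₃ ∷ []) ∷
  sortᶠ (c₀₂ ∷ c₂₃ ∷ c₀₃ ∷ []) ∷ sortᶠ (c₁₂ ∷ c₂₃ ∷ c₁₃ ∷ []) ∷ []

K₄-sortedPalettes-repeat : ∀ c₀₁ c₀₂ c₀₃ c₁₂ c₁₃ c₂₃ → ¬ Unique (K₄-sortedPalettes c₀₁ c₀₂ c₀₃ c₁₂ c₁₃ c₂₃)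
K₄-sortedPalettes-repeat = from-yes
  (all? λ c₀₁ → all? λ c₀₂ → all? λ c₀₃ → all? λ c₁₂ → all? λ c₁₃ → all? λ c₂₃ →
   ¬? (unique? (K₄-sortedPalettes c₀₁ c₀₂ c₀₃ c₁₂ c₁₃ c₂₃)))

K₄-¬distinguishes : (f : EdgeColoring 4 2) → ¬ DistinguishesTriangles f
K₄-¬distinguishes f distinguishes =
  K₄-sortedPalettes-repeat (col f (# 0) (# 1)) (col f (# 0) (# 2)) (col f (# 0) (# 3))
                           (col f (# 1) (# 2)) (col f (# 1) (# 3)) (col f (# 2) (# 3))
    -- map (sortᶠ ∘ palette f) K₄-triangles computes to K₄-sortedPalettes of the six edge colours
    (Unique.map⁺ {f = λ t → sortᶠ (palette f t)} (sortedPalette-injective {f = f} distinguishes)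
                 K₄-triangles-unique)

tooFewColours⇒¬distinguishes : ∀ {m k} → 2 ≤ m → k ≤ m → (f : EdgeColoring (2 + m) k) → ¬ DistinguishesTriangles f
tooFewColours⇒¬distinguishes 2≤m k≤m f with m≤n⇒m<n∨m≡n k≤m
... | inj₁ k<m = Slack⇒¬distinguishes k≤m (<⇒Slack k<m) f
... | inj₂ refl with m≤n⇒m<n∨m≡n 2≤m
...   | inj₁ 2<m  = Slack⇒¬distinguishes k≤m (2<⇒Slack-diagonal 2<m) f
...   | inj₂ refl = K₄-¬distinguishes f

mainTheorem3 : (n : ℕ) → 4 ≤ n → (k : ℕ) →
    Σ (EdgeColoring n k) DistinguishesTriangles → n ∸ 1 ≤ k
mainTheorem3 _ (s≤s (s≤s 2≤m)) k (f , distinguishes) =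
  ≮⇒≥ λ k<n∸1 → tooFewColours⇒¬distinguishes 2≤m (s≤s⁻¹ k<n∸1) f distinguishes
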